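{- For all positive integers $d,n$, $$|\mathfrak{Bl}_{d,n}|=d^{n}\sum_{k=1}^{n}\chi_k^{(n)}(1+d)^k.$$
   Context: TL-diagrams: place top points $1,\dots,n$ and bottom points $1',\dots,n'$ on the two boundary lines of the strip $\mathbb{R}\times[0,1]$; a TL-diagram on $n$ points is a non-crossing perfect matching of these $2n$ points drawn as $n$ disjoint arcs in the strip, up to isotopy. The left side is the unbounded complementary region containing points $(x,1/2)$ with $x$ very negative; an arc is exposed to the left side if it lies on the boundary of that region. For $k\in[1,n]$, $\chi_k^{(n)}$ is the number of TL-diagrams on $n$ points with exactly $k$ arcs exposed to the left side. A blobbed TL-diagram is a TL-diagram in which some left-exposed arcs carry one blob each. Abacus blob monoid $\mathfrak{Bl}_{d,n}$: an element is a blobbed TL-diagram together with a label in $\mathbb{Z}/d\mathbb{Z}$ on each component, where an unblobbed arc is one component and a blobbed arc is split by its blob into two components, each containing one endpoint; two elements are equal iff their diagrams and all labels agree. Product $X\cdot Y$: place $X$ above $Y$, identify the bottom points of $X$ with the top points of $Y$; delete closed loops with their decorations; each resulting arc is a chain of pieces; if no piece has a blob, the arc is unblobbed with label the sum of all labels along it; otherwise it carries exactly one blob and each of its two components gets the sum of labels met travelling from the corresponding endpoint up to the first blob (labels between blobs are discarded). -}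

module Defs where

open import Data.Nat using (ℕ; zero; suc; _+_; _*_; _^_; _<_; _≤_)
open import Data.Nat.Properties using (_<?_; _≟_)
open import Data.Fin using (Fin; toℕ)
open import Data.Fin.Properties using (all?; any?)
open import Data.Vec using (Vec; lookup)
open import Data.Bool using (Bool; true; false)
open import Data.List using (List; length; filter; allFin)
open import Data.Product using (Σ; _×_; _,_)
open import Data.Sum using (_⊎_)
open import Data.Empty using (⊥)
open import Relation.Nullary using (¬_; Dec; yes; no)
open import Relation.Nullary.Decidable using (True; ¬?; _×-dec_; _⊎-dec_; _→-dec_)
open import Relation.Binary.PropositionalEquality using (_≡_; _≢_)
open import Function.Bundles using (_↔_)
import Data.Fin.Properties as FinP
import Data.Bool.Properties as BoolP

-- The 2n boundary points are indexed by  Fin (n + n)  following the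
-- boundary of the strip (viewed as a disk) in circular order, starting
-- just after the left side:
--   index i      (0 ≤ i < n)  is the top point      i+1,
--   index n + j  (0 ≤ j < n)  is the bottom point  (n-j)'.
-- So the indices run  1, 2, …, n, n', …, 2', 1'  and the left side of
-- the strip is the boundary gap between the last index (1') and the
-- first index (1).

Pt : ℕ → Set
Pt n = Fin (n + n)

_≺_ : ∀ {N} → Fin N → Fin N → Set
i ≺ j = toℕ i < toℕ j

_≺?_ : ∀ {N} (i j : Fin N) → Dec (i ≺ j)
i ≺? j = toℕ i <? toℕ j

RawMatching : ℕ → Set
RawMatching n = Vec (Pt n) (n + n)

module _ {n : ℕ} (m : RawMatching n) where

  partner : Pt n → Pt n
  partner i = lookup m i

  IsInvolution : Set
  IsInvolution = ∀ i → partner (partner i) ≡ i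

  FixedPointFree : Set
  FixedPointFree = ∀ i → partner i ≢ i

  -- two arcs {i, m i}, {j, m j} cross iff their endpoints interleave
  -- along the boundary:  i < j < m i < m j
  NonCrossing : Set
  NonCrossing = ∀ i j → ¬ ((i ≺ j × j ≺ partner i) × partner i ≺ partner j)

  IsTL : Set
  IsTL = (IsInvolution × FixedPointFree) × NonCrossing

  isTL? : Dec IsTL
  isTL? = ((all? λ i → partner (partner i) FinP.≟ i)
           ×-dec (all? λ i → ¬? (partner i FinP.≟ i)))
          ×-dec (all? λ i → all? λ j →
                   ¬? (((i ≺? j) ×-dec (j ≺? partner i))
                        ×-dec (partner i ≺? partner j)))

  -- The arc with left endpoint i (i < m i) is exposed to the left side
  -- iff it is not nested inside another arc, i.e. there is no arc
  -- {j, m j} with  j < i < m i < m j  (the left side is the face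
  -- adjacent to the boundary gap between the last and the first point).
  LeftExposedAt : Pt n → Set
  LeftExposedAt i = i ≺ partner i × (∀ j → ¬ (j ≺ i × partner i ≺ partner j))

  leftExposedAt? : ∀ i → Dec (LeftExposedAt i)
  leftExposedAt? i = (i ≺? partner i)
    ×-dec all? (λ j → ¬? ((j ≺? i) ×-dec (partner i ≺? partner j)))

  ArcLeftExposed : Pt n → Set
  ArcLeftExposed i = LeftExposedAt i ⊎ LeftExposedAt (partner i)

  arcLeftExposed? : ∀ i → Dec (ArcLeftExposed i)
  arcLeftExposed? i = leftExposedAt? i ⊎-dec leftExposedAt? (partner i)

  -- number of arcs exposed to the left side (each arc counted once,
  -- via its first endpoint)
  #leftExposed : ℕ
  #leftExposed = length (filter leftExposedAt? (allFin (n + n)))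

HasCard : Set → ℕ → Set
HasCard A c = A ↔ Fin c

-- TL-diagrams on n points with exactly k arcs exposed to the left side.
-- χ_k^(n) is the cardinality of this type.

TLWithExposed : ℕ → ℕ → Set
TLWithExposed n k =
  Σ (RawMatching n) λ m → True (isTL? {n} m ×-dec (#leftExposed {n} m ≟ k))

-- Raw data: a matching m, a blob flag on each point, and a label in
-- Z/dZ (= Fin d) on each point.  The flag/label of a point is read as:
--   * blob flag: whether the arc through that point carries a blob
--     (so it must agree at both endpoints of an arc);
--   * label: the label of the component containing that point.  An
--     unblobbed arc is a single component, so both of its endpoints carry
--     the same label; a blobbed arc is split into two components, one per
--     endpoint, whose labels are independent.

RawBl : ℕ → ℕ → Set
RawBl d n = RawMatching n × Vec Bool (n + n) × Vec (Fin d) (n + n)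

module _ {d n : ℕ} where

  IsBl : RawBl d n → Set
  IsBl (m , b , ℓ) =
    IsTL {n} m
    × (∀ i → lookup b i ≡ lookup b (partner {n} m i))
    × (∀ i → lookup b i ≡ true → ArcLeftExposed {n} m i)
    × (∀ i → lookup b i ≡ false → lookup ℓ i ≡ lookup ℓ (partner {n} m i))

  isBl? : (x : RawBl d n) → Dec (IsBl x)
  isBl? (m , b , ℓ) =
    isTL? {n} m
    ×-dec (all? λ i → lookup b i BoolP.≟ lookup b (partner {n} m i))
    ×-dec (all? λ i → (lookup b i BoolP.≟ true) →-dec arcLeftExposed? {n} m i)
    ×-dec (all? λ i → (lookup b i BoolP.≟ false)
                      →-dec (lookup ℓ i FinP.≟ lookup ℓ (partner {n} m i)))

Bl : ℕ → ℕ → Set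
Bl d n = Σ (RawBl d n) λ x → True (isBl? {d} {n} x)

sum1to : ℕ → (ℕ → ℕ) → ℕ
sum1to zero    f = 0
sum1to (suc n) f = sum1to n f + f (suc n)

-- Fix the underlying TL-diagram.  Its 2n points are paired by a fixed-point-free
-- involution, so they split into the lower and the upper endpoints of its n arcs,
-- and a valid decoration is the same as an independent choice for every arc:
-- an unblobbed arc carries one label (d choices), while a left-exposed arc may
-- instead carry a blob and two labels (d + d² = d(1 + d) choices).  A diagram
-- with k left-exposed arcs therefore has d^n (1 + d)^k decorations, and grouping
-- the diagrams by k (which lies in [1, n], the arc at the first point being
-- left-exposed) gives the formula.

module Submission where

open import Defs
open import Data.Bool using (Bool; true; false; T; if_then_else_)
open import Data.Bool.Properties using (T-irrelevant)
open import Data.Fin using (Fin; zero; suc)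
open import Data.Fin.Permutation using (↔⇒≡)
open import Data.Fin.Properties using (1↔⊤; +↔⊎; *↔×; toℕ-injective)
import Data.List as List
open import Data.List.Properties using (filter-accept)
open import Data.Nat using (ℕ; zero; suc; _+_; _*_; _^_; _≤_; _≤?_; z≤n; s≤s; ⌊_/2⌋)
open import Data.Nat.Properties
open import Algebra.Properties.CommutativeSemigroup *-commutativeSemigroup using (interchange; x∙yz≈y∙xz)
open import Data.Product using (Σ; _×_; _,_; proj₁; proj₂)
open import Data.Product.Function.Dependent.Propositional using (Σ-↔)
open import Data.Product.Function.NonDependent.Propositional using (_×-↔_)
open import Data.Sum using (_⊎_; inj₁; inj₂)
open import Data.Sum.Function.Propositional using (_⊎-↔_)
open import Data.Unit using (tt)
open import Data.Vec using (Vec; []; _∷_; tabulate; lookup; count; zip)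
open import Data.Vec.Properties using (lookup∘tabulate; tabulate∘lookup; tabulate-cong; lookup-zip; ×v↔v×; count≤n)
open import Data.Vec.Relation.Binary.Pointwise.Inductive using (Pointwise; []; _∷_; tabulate⁺; tabulate⁻)
open import Function using (_∘_; id)
open import Function.Bundles using (_↔_; _⇔_; mk↔ₛ′; mk⇔; Inverse; Equivalence)
open import Function.Properties.Inverse using (↔-refl; ↔-sym; ↔-trans)
open import Function.Related.Propositional using (module EquationalReasoning)
open import Function.Related.TypeIsomorphisms using (⊎-comm; Σ-distribʳ-⊎)
open import Level using (0ℓ)
open import Relation.Binary.Core using (REL)
open import Relation.Binary.PropositionalEquality using (_≡_; _≢_; refl; sym; trans; cong; cong₂; subst; subst₂)
open import Relation.Nullary using (Dec; yes; no; does; Irrelevant; contradiction; ¬_)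
open import Relation.Nullary.Decidable using (True; toWitness; fromWitness; _×-dec_)
open import Relation.Unary using (Pred; Decidable)

private
  variable
    A X : Set
    n : ℕ

True-⇔-↔ : {B : Set} (a? : Dec A) → Irrelevant B → A ⇔ B → True a? ↔ B
True-⇔-↔ a? B-irrelevant A⇔B =
  mk↔ₛ′ (Equivalence.to A⇔B ∘ toWitness) (fromWitness ∘ Equivalence.from A⇔B)
        (λ _ → B-irrelevant _ _) (λ _ → T-irrelevant _ _)

T-does-⇔ : (a? : Dec A) → T (does a?) ⇔ A
T-does-⇔ (yes a) = mk⇔ (λ _ → a) (λ _ → tt)
T-does-⇔ (no ¬a) = mk⇔ (λ ()) ¬a

⊎-emptyˡ-↔ : {B : Set} → ¬ A → (A ⊎ B) ↔ B
⊎-emptyˡ-↔ ¬a = mk↔ₛ′ (λ { (inj₁ a) → contradiction a ¬a ; (inj₂ b) → b }) inj₂ (λ _ → refl)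
                      (λ { (inj₁ a) → contradiction a ¬a ; (inj₂ _) → refl })

Σ-Fin-suc-↔ : {P : Fin (suc n) → Set} → Σ (Fin (suc n)) P ↔ (P zero ⊎ Σ (Fin n) (P ∘ suc))
Σ-Fin-suc-↔ = mk↔ₛ′
  (λ { (zero , p) → inj₁ p ; (suc i , p) → inj₂ (i , p) })
  (λ { (inj₁ p) → zero , p ; (inj₂ (i , p)) → suc i , p })
  (λ { (inj₁ _) → refl ; (inj₂ _) → refl })
  (λ { (zero , _) → refl ; (suc _ , _) → refl })

Σ-True-tabulate-↔ : {P : Pred A 0ℓ} (P? : Decidable P) (f : Fin n → A) →
                    Σ (Fin n) (λ i → True (P? (f i))) ↔ Fin (count P? (tabulate f))
Σ-True-tabulate-↔ {n = zero}  P? f = mk↔ₛ′ (λ ()) (λ ()) (λ ()) (λ ())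
Σ-True-tabulate-↔ {n = suc n} {P = P} P? f = ↔-trans Σ-Fin-suc-↔ (head (P? (f zero)))
  where
  tail = Σ-True-tabulate-↔ P? (f ∘ suc)
  head : (P?₀ : Dec (P (f zero))) →
         (True P?₀ ⊎ Σ (Fin n) (λ i → True (P? (f (suc i)))))
           ↔ Fin ((if does P?₀ then suc else id) (count P? (tabulate (f ∘ suc))))
  head (yes _) = ↔-trans (↔-sym 1↔⊤ ⊎-↔ tail) (↔-sym +↔⊎)
  head (no  _) = ↔-trans (⊎-emptyˡ-↔ id) tail

count-tabulate≡length-filter : {P : Pred A 0ℓ} (P? : Decidable P) (f : Fin n → A) →
                               count P? (tabulate f) ≡ List.length (List.filter P? (List.tabulate f))
count-tabulate≡length-filter {n = zero}  P? f = refl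
count-tabulate≡length-filter {n = suc n} P? f with does (P? (f zero))
... | true  = cong suc (count-tabulate≡length-filter P? (f ∘ suc))
... | false = count-tabulate≡length-filter P? (f ∘ suc)

Pointwise-irrelevant : {R : REL A X 0ℓ} → (∀ {a x} → Irrelevant (R a x)) →
                       {as : Vec A n} {xs : Vec X n} → Irrelevant (Pointwise R as xs)
Pointwise-irrelevant R-irrelevant []       []         = refl
Pointwise-irrelevant R-irrelevant (r ∷ rs) (r′ ∷ rs′) =
  cong₂ _∷_ (R-irrelevant r r′) (Pointwise-irrelevant R-irrelevant rs rs′)

Σ-Pointwise-∷-↔ : {R : REL A X 0ℓ} {a : A} {as : Vec A n} →
                  Σ (Vec X (suc n)) (Pointwise R (a ∷ as)) ↔ (Σ X (R a) × Σ (Vec X n) (Pointwise R as))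
Σ-Pointwise-∷-↔ = mk↔ₛ′
  (λ { (x ∷ xs , r ∷ rs) → (x , r) , (xs , rs) })
  (λ { ((x , r) , (xs , rs)) → x ∷ xs , r ∷ rs })
  (λ _ → refl)
  (λ { (_ ∷ _ , _ ∷ _) → refl })

Σ-Pointwise-↔ : {R : REL A X 0ℓ} {P : Pred A 0ℓ} (P? : Decidable P) {u v : ℕ} →
                (∀ a → Σ X (R a) ↔ Fin (if does (P? a) then u * v else u)) →
                (as : Vec A n) → Σ (Vec X n) (Pointwise R as) ↔ Fin (u ^ n * v ^ count P? as)
Σ-Pointwise-↔ P? R-↔ [] = mk↔ₛ′ (λ _ → zero) (λ _ → [] , []) (λ { zero → refl }) (λ { ([] , []) → refl })
Σ-Pointwise-↔ {X = X} {n = suc n} {R = R} P? {u} {v} R-↔ (a ∷ as) = begin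
  Σ (Vec X (suc n)) (Pointwise R (a ∷ as))                ↔⟨ Σ-Pointwise-∷-↔ ⟩
  (Σ X (R a) × Σ (Vec X n) (Pointwise R as))              ↔⟨ R-↔ a ×-↔ Σ-Pointwise-↔ P? R-↔ as ⟩
  (Fin (q (does (P? a))) × Fin (u ^ n * v ^ count P? as)) ↔⟨ ↔-sym *↔× ⟩
  Fin (q (does (P? a)) * (u ^ n * v ^ count P? as))      ≡⟨ cong Fin (factor (does (P? a))) ⟩
  Fin (u ^ suc n * v ^ count P? (a ∷ as))                 ∎
  where
  open EquationalReasoning
  q : Bool → ℕ
  q b = if b then u * v else u
  factor : ∀ b → q b * (u ^ n * v ^ count P? as) ≡ u ^ suc n * v ^ (if b then suc else id) (count P? as)
  factor true  = interchange u v (u ^ n) (v ^ count P? as)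
  factor false = sym (*-assoc u (u ^ n) _)

m+m≡n+n⇒m≡n : ∀ {m n} → m + m ≡ n + n → m ≡ n
m+m≡n+n⇒m≡n {m} {n} eq = trans (n≡⌊n+n/2⌋ m) (trans (cong ⌊_/2⌋ eq) (sym (n≡⌊n+n/2⌋ n)))

sum1to-cong : ∀ {f g : ℕ → ℕ} n → (∀ k → f k ≡ g k) → sum1to n f ≡ sum1to n g
sum1to-cong zero    f≡g = refl
sum1to-cong (suc n) f≡g = cong₂ _+_ (sum1to-cong n f≡g) (f≡g (suc n))

sum1to-*ˡ : ∀ c (f : ℕ → ℕ) n → sum1to n (λ k → c * f k) ≡ c * sum1to n f
sum1to-*ˡ c f zero    = sym (*-zeroʳ c)
sum1to-*ˡ c f (suc n) = trans (cong (_+ c * f (suc n)) (sum1to-*ˡ c f n)) (sym (*-distribˡ-+ c _ _))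

-- Partitioning a Σ-type by a size function

module _ {A : Set} (size : A → ℕ) (F : A → Set) where

  AtMost : ℕ → Set
  AtMost j = Σ A (λ a → size a ≤ j)

  Exactly : ℕ → Set
  Exactly k = Σ A (λ a → size a ≡ k)

  Σ-AtMost-suc-↔ : ∀ j → Σ (AtMost (suc j)) (F ∘ proj₁)
                       ↔ (Σ (AtMost j) (F ∘ proj₁) ⊎ Σ (Exactly (suc j)) (F ∘ proj₁))
  Σ-AtMost-suc-↔ j = mk↔ₛ′ to from to∘from from∘to
    where
    to : Σ (AtMost (suc j)) (F ∘ proj₁) → Σ (AtMost j) (F ∘ proj₁) ⊎ Σ (Exactly (suc j)) (F ∘ proj₁)
    to ((a , ≤suc) , x) with size a ≤? j
    ... | yes ≤j = inj₁ ((a , ≤j) , x)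
    ... | no  ≰j = inj₂ ((a , ≤-antisym ≤suc (≰⇒> ≰j)) , x)
    from : Σ (AtMost j) (F ∘ proj₁) ⊎ Σ (Exactly (suc j)) (F ∘ proj₁) → Σ (AtMost (suc j)) (F ∘ proj₁)
    from (inj₁ ((a , ≤j) , x))   = (a , m≤n⇒m≤1+n ≤j) , x
    from (inj₂ ((a , ≡suc) , x)) = (a , ≤-reflexive ≡suc) , x
    to∘from : ∀ y → to (from y) ≡ y
    to∘from (inj₁ ((a , ≤j) , x)) with size a ≤? j
    ... | yes ≤j′ = cong (λ le → inj₁ ((a , le) , x)) (≤-irrelevant ≤j′ ≤j)
    ... | no  ≰j  = contradiction ≤j ≰j
    to∘from (inj₂ ((a , ≡suc) , x)) with size a ≤? j
    ... | yes ≤j = contradiction (≤-trans (≤-reflexive (sym ≡suc)) ≤j) (n≮n j)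
    ... | no  _  = cong (λ eq → inj₂ ((a , eq) , x)) (≡-irrelevant _ _)
    from∘to : ∀ y → from (to y) ≡ y
    from∘to ((a , ≤suc) , x) with size a ≤? j
    ... | yes _ = cong (λ le → (a , le) , x) (≤-irrelevant _ _)
    ... | no  _ = cong (λ le → (a , le) , x) (≤-irrelevant _ _)

  module _ {g : ℕ → ℕ} (F-↔ : ∀ a → F a ↔ Fin (g (size a))) where

    Σ-Exactly-↔ : ∀ k → Σ (Exactly k) (F ∘ proj₁) ↔ (Exactly k × Fin (g k))
    Σ-Exactly-↔ k = Σ-↔ ↔-refl λ { {a , refl} → F-↔ a }

    Σ-AtMost-↔ : (∀ a → 1 ≤ size a) → (χ : ℕ → ℕ) → ∀ j →
                 (∀ k → 1 ≤ k → k ≤ j → Exactly k ↔ Fin (χ k)) →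
                 Σ (AtMost j) (F ∘ proj₁) ↔ Fin (sum1to j (λ k → χ k * g k))
    Σ-AtMost-↔ size-pos χ zero χ-↔ = mk↔ₛ′ (λ y → contradiction y empty) (λ ()) (λ ()) (λ y → contradiction y empty)
      where
      empty : ¬ Σ (AtMost 0) (F ∘ proj₁)
      empty ((a , ≤0) , _) = contradiction (≤-trans (size-pos a) ≤0) λ ()
    Σ-AtMost-↔ size-pos χ (suc j) χ-↔ = begin
      Σ (AtMost (suc j)) (F ∘ proj₁)                               ↔⟨ Σ-AtMost-suc-↔ j ⟩
      (Σ (AtMost j) (F ∘ proj₁) ⊎ Σ (Exactly (suc j)) (F ∘ proj₁)) ↔⟨ below-suc-j ⊎-↔ Σ-Exactly-↔ (suc j) ⟩
      (Fin (sum1to j h) ⊎ (Exactly (suc j) × Fin (g (suc j))))    ↔⟨ ↔-refl ⊎-↔ (χ-↔ (suc j) (s≤s z≤n) ≤-refl ×-↔ ↔-refl) ⟩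
      (Fin (sum1to j h) ⊎ (Fin (χ (suc j)) × Fin (g (suc j))))    ↔⟨ ↔-refl ⊎-↔ ↔-sym *↔× ⟩
      (Fin (sum1to j h) ⊎ Fin (h (suc j)))                        ↔⟨ ↔-sym +↔⊎ ⟩
      Fin (sum1to (suc j) h)                                      ∎
      where
      open EquationalReasoning
      h : ℕ → ℕ
      h k = χ k * g k
      below-suc-j = Σ-AtMost-↔ size-pos χ j (λ k 1≤k k≤j → χ-↔ k 1≤k (m≤n⇒m≤1+n k≤j))

    Σ-partition-↔ : ∀ {n} → (∀ a → 1 ≤ size a) → (∀ a → size a ≤ n) → (χ : ℕ → ℕ) →
                    (∀ k → 1 ≤ k → k ≤ n → Exactly k ↔ Fin (χ k)) →
                    Σ A F ↔ Fin (sum1to n (λ k → χ k * g k))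
    Σ-partition-↔ {n} size-pos size≤n χ χ-↔ =
      ↔-trans (mk↔ₛ′ (λ { (a , x) → (a , size≤n a) , x }) (λ { ((a , _) , x) → a , x })
                     (λ { ((a , _) , x) → cong (λ le → (a , le) , x) (≤-irrelevant _ _) }) (λ _ → refl))
              (Σ-AtMost-↔ size-pos χ n χ-↔)

-- Points paired up by a fixed-point-free involution

module _ {N c : ℕ} (σ : Fin N ↔ (Fin c ⊎ Fin c)) where
  open Inverse σ using () renaming (to to split; from to join)

  pairUp : Vec A N → Vec (A × A) c
  pairUp v = tabulate (λ t → lookup v (join (inj₁ t)) , lookup v (join (inj₂ t)))

  pairUp-↔ : Vec A N ↔ Vec (A × A) c
  pairUp-↔ {A = A} = mk↔ₛ′ pairUp unpair pairUp∘unpair unpair∘pairUp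
    where
    pick : Fin c ⊎ Fin c → Vec (A × A) c → A
    pick (inj₁ t) w = proj₁ (lookup w t)
    pick (inj₂ t) w = proj₂ (lookup w t)
    unpair : Vec (A × A) c → Vec A N
    unpair w = tabulate (λ i → pick (split i) w)
    lookup-unpair : ∀ w s → lookup (unpair w) (join s) ≡ pick s w
    lookup-unpair w s = trans (lookup∘tabulate _ (join s)) (cong (λ s′ → pick s′ w) (Inverse.strictlyInverseˡ σ s))
    pick-pairUp : ∀ v s → pick s (pairUp v) ≡ lookup v (join s)
    pick-pairUp v (inj₁ t) = cong proj₁ (lookup∘tabulate _ t)
    pick-pairUp v (inj₂ t) = cong proj₂ (lookup∘tabulate _ t)
    pairUp∘unpair : ∀ w → pairUp (unpair w) ≡ w
    pairUp∘unpair w = trans (tabulate-cong λ t → cong₂ _,_ (lookup-unpair w (inj₁ t)) (lookup-unpair w (inj₂ t)))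
                            (tabulate∘lookup w)
    unpair∘pairUp : ∀ v → unpair (pairUp v) ≡ v
    unpair∘pairUp v = trans (tabulate-cong λ i → trans (pick-pairUp v (split i)) (cong (lookup v) (Inverse.strictlyInverseʳ σ i)))
                            (tabulate∘lookup v)

  ∀-split-⇔ : {Q : Fin N → Set} → (∀ i → Q i) ⇔ (∀ t → Q (join (inj₁ t)) × Q (join (inj₂ t)))
  ∀-split-⇔ {Q = Q} = mk⇔ (λ h t → h _ , h _) (λ h i → subst Q (Inverse.strictlyInverseʳ σ i) (at-join h (split i)))
    where
    at-join : (∀ t → Q (join (inj₁ t)) × Q (join (inj₂ t))) → ∀ s → Q (join s)
    at-join h (inj₁ t) = proj₁ (h t)
    at-join h (inj₂ t) = proj₂ (h t)

module FixedPointFreeInvolution {N : ℕ} {p : Fin N → Fin N}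
         (p-involutive : ∀ i → p (p i) ≡ i) (p-fixedPointFree : ∀ i → p i ≢ i) where

  Lower : Set
  Lower = Σ (Fin N) (λ i → True (i ≺? p i))

  Lower-≡ : ∀ {i j} {l : True (i ≺? p i)} {l′ : True (j ≺? p j)} → i ≡ j → _≡_ {A = Lower} (i , l) (j , l′)
  Lower-≡ {i} refl = cong (i ,_) (T-irrelevant _ _)

  ¬lower⇒partner-lower : ∀ i → ¬ (i ≺ p i) → p i ≺ p (p i)
  ¬lower⇒partner-lower i ¬lower rewrite p-involutive i =
    ≤∧≢⇒< (≮⇒≥ ¬lower) (λ eq → p-fixedPointFree i (toℕ-injective eq))

  lower⇒partner-¬lower : ∀ i → i ≺ p i → ¬ (p i ≺ p (p i))
  lower⇒partner-¬lower i lower upper = <-asym lower (subst (p i ≺_) (p-involutive i) upper)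

  endpoints-↔ : Fin N ↔ (Lower ⊎ Lower)
  endpoints-↔ = mk↔ₛ′ (λ i → classify i (i ≺? p i)) from
    (λ { (inj₁ (i , l)) → classify-lower (i ≺? p i) l ; (inj₂ (i , l)) → classify-upper (p i ≺? p (p i)) l })
    (λ i → from-classify (i ≺? p i))
    where
    classify : ∀ i → Dec (i ≺ p i) → Lower ⊎ Lower
    classify i (yes lower)  = inj₁ (i , fromWitness lower)
    classify i (no  ¬lower) = inj₂ (p i , fromWitness (¬lower⇒partner-lower i ¬lower))
    from : Lower ⊎ Lower → Fin N
    from (inj₁ (i , _)) = i
    from (inj₂ (i , _)) = p i
    classify-lower : ∀ {i} (i≺?pi : Dec (i ≺ p i)) (l : True (i ≺? p i)) → classify i i≺?pi ≡ inj₁ (i , l)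
    classify-lower (yes _)      _ = cong inj₁ (Lower-≡ refl)
    classify-lower (no  ¬lower) l = contradiction (toWitness l) ¬lower
    classify-upper : ∀ {i} (pi≺?ppi : Dec (p i ≺ p (p i))) (l : True (i ≺? p i)) → classify (p i) pi≺?ppi ≡ inj₂ (i , l)
    classify-upper {i} (yes upper) l = contradiction upper (lower⇒partner-¬lower i (toWitness l))
    classify-upper {i} (no  _)     _ = cong inj₂ (Lower-≡ (p-involutive i))
    from-classify : ∀ {i} (i≺?pi : Dec (i ≺ p i)) → from (classify i i≺?pi) ≡ i
    from-classify     (yes _) = refl
    from-classify {i} (no  _) = p-involutive i

  #arcs : ℕ
  #arcs = count (λ i → i ≺? p i) (tabulate id)

  arcs-↔ : Lower ↔ Fin #arcs
  arcs-↔ = Σ-True-tabulate-↔ (λ i → i ≺? p i) id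

  ends-↔ : Fin N ↔ (Fin #arcs ⊎ Fin #arcs)
  ends-↔ = ↔-trans endpoints-↔ (arcs-↔ ⊎-↔ arcs-↔)

  -- The upper endpoint Inverse.from ends-↔ (inj₂ t) reduces to p (lowerEnd t).
  lowerEnd : Fin #arcs → Fin N
  lowerEnd t = Inverse.from ends-↔ (inj₁ t)

  lowerEnd-lower : ∀ t → lowerEnd t ≺ p (lowerEnd t)
  lowerEnd-lower t = toWitness (proj₂ (Inverse.from arcs-↔ t))

  #arcs+#arcs≡N : #arcs + #arcs ≡ N
  #arcs+#arcs≡N = sym (↔⇒≡ (↔-trans ends-↔ (↔-sym +↔⊎)))

  Σ-lowerEnd-↔ : {P : Fin N → Set} → (∀ i → P i → i ≺ p i) → Σ (Fin #arcs) (P ∘ lowerEnd) ↔ Σ (Fin N) P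
  Σ-lowerEnd-↔ {P} P⇒lower = begin
    Σ (Fin #arcs) (P ∘ lowerEnd)                                       ↔⟨ ↔-sym (⊎-emptyˡ-↔ at-upperEnd) ⟩
    (Σ (Fin #arcs) (P ∘ p ∘ lowerEnd) ⊎ Σ (Fin #arcs) (P ∘ lowerEnd)) ↔⟨ ⊎-comm _ _ ⟩
    (Σ (Fin #arcs) (P ∘ lowerEnd) ⊎ Σ (Fin #arcs) (P ∘ p ∘ lowerEnd)) ↔⟨ ↔-sym Σ-distribʳ-⊎ ⟩
    Σ (Fin #arcs ⊎ Fin #arcs) (P ∘ Inverse.from ends-↔)                ↔⟨ Σ-↔ (↔-sym ends-↔) ↔-refl ⟩
    Σ (Fin N) P                                                        ∎
    where
    open EquationalReasoning
    at-upperEnd : ¬ Σ (Fin #arcs) (P ∘ p ∘ lowerEnd)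
    at-upperEnd (t , x) = lower⇒partner-¬lower (lowerEnd t) (lowerEnd-lower t) (P⇒lower _ x)

-- Decorations of a single arc

-- Indexed by the (blob flag, label) pairs at the arc's lower and upper endpoint.
data ArcDecoration {d : ℕ} (exposed : Bool) : (Bool × Fin d) × (Bool × Fin d) → Set where
  unblobbed : ∀ l → ArcDecoration exposed ((false , l) , (false , l))
  blobbed   : T exposed → ∀ l l′ → ArcDecoration exposed ((true , l) , (true , l′))

module _ {d : ℕ} where

  ArcDecoration-irrelevant : ∀ {e x} → Irrelevant (ArcDecoration {d} e x)
  ArcDecoration-irrelevant (unblobbed _)   (unblobbed _)    = refl
  ArcDecoration-irrelevant (blobbed t _ _) (blobbed t′ _ _) = cong (λ t → blobbed t _ _) (T-irrelevant t t′)

  ArcDecoration-⇔ : ∀ {e β β′} {l l′ : Fin d} →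
                    ArcDecoration e ((β , l) , (β′ , l′)) ⇔ ((β ≡ β′) × (β ≡ true → T e) × (β ≡ false → l ≡ l′))
  ArcDecoration-⇔ = mk⇔ to from
    where
    to : ∀ {e β β′ l l′} → ArcDecoration e ((β , l) , (β′ , l′)) → (β ≡ β′) × (β ≡ true → T e) × (β ≡ false → l ≡ l′)
    to (unblobbed _)   = refl , (λ ()) , (λ _ → refl)
    to (blobbed t _ _) = refl , (λ _ → t) , (λ ())
    from : ∀ {e β β′ l l′} → (β ≡ β′) × (β ≡ true → T e) × (β ≡ false → l ≡ l′) → ArcDecoration e ((β , l) , (β′ , l′))
    from {β = false} (refl , _ , same) rewrite same refl = unblobbed _
    from {β = true}  (refl , exposed , _) = blobbed (exposed refl) _ _

  ArcDecoration-↔ : ∀ e → Σ _ (ArcDecoration {d} e) ↔ Fin (if e then d * suc d else d)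
  ArcDecoration-↔ false = mk↔ₛ′ (λ { (_ , unblobbed l) → l ; (_ , blobbed () _ _) }) (λ l → _ , unblobbed l)
                                (λ _ → refl) (λ { (_ , unblobbed _) → refl ; (_ , blobbed () _ _) })
  ArcDecoration-↔ true = begin
    Σ _ (ArcDecoration true) ↔⟨ mk↔ₛ′ to from (λ { (inj₁ _) → refl ; (inj₂ _) → refl })
                                               (λ { (_ , unblobbed _) → refl ; (_ , blobbed _ _ _) → refl }) ⟩
    (Fin d ⊎ Fin d × Fin d)  ↔⟨ ↔-refl ⊎-↔ ↔-sym *↔× ⟩
    (Fin d ⊎ Fin (d * d))    ↔⟨ ↔-sym +↔⊎ ⟩
    Fin (d + d * d)          ≡⟨ cong Fin (sym (*-suc d d)) ⟩
    Fin (d * suc d)          ∎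
    where
    open EquationalReasoning
    to : Σ _ (ArcDecoration true) → Fin d ⊎ Fin d × Fin d
    to (_ , unblobbed l)    = inj₁ l
    to (_ , blobbed _ l l′) = inj₂ (l , l′)
    from : Fin d ⊎ Fin d × Fin d → Σ _ (ArcDecoration true)
    from (inj₁ l)        = _ , unblobbed l
    from (inj₂ (l , l′)) = _ , blobbed tt l l′

-- Decorations of a TL-diagram

-- n is passed explicitly throughout: RawMatching n does not determine it.
Decorations : (d n : ℕ) → RawMatching n → Set
Decorations d n m = Σ (Vec Bool (n + n) × Vec (Fin d) (n + n)) (λ bℓ → True (isBl? {d} {n} (m , bℓ)))

module Decoration (d n : ℕ) (m : RawMatching n) (tl : IsTL {n} m) where

  private
    p = partner {n} m
    p-involutive = proj₁ (proj₁ tl)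
  open FixedPointFreeInvolution p-involutive (proj₂ (proj₁ tl))

  exposed : Fin (n + n) → Bool
  exposed i = does (leftExposedAt? {n} m i)

  ArcLeftExposed-partner : ∀ {i} → ArcLeftExposed {n} m i → ArcLeftExposed {n} m (p i)
  ArcLeftExposed-partner {i} (inj₁ at-i) = inj₂ (subst (LeftExposedAt {n} m) (sym (p-involutive i)) at-i)
  ArcLeftExposed-partner     (inj₂ at-p) = inj₁ at-p

  ArcLeftExposed⇔exposed : ∀ {i} → i ≺ p i → ArcLeftExposed {n} m i ⇔ T (exposed i)
  ArcLeftExposed⇔exposed {i} lower = mk⇔ to (inj₁ ∘ Equivalence.to exposed⇔)
    where
    exposed⇔ = T-does-⇔ (leftExposedAt? {n} m i)
    to : ArcLeftExposed {n} m i → T (exposed i)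
    to (inj₁ at-i) = Equivalence.from exposed⇔ at-i
    to (inj₂ at-p) = contradiction (proj₁ at-p) (lower⇒partner-¬lower i lower)

  module _ (b : Vec Bool (n + n)) (ℓ : Vec (Fin d) (n + n)) where

    PointValid : Fin (n + n) → Set
    PointValid i = (lookup b i ≡ lookup b (p i))
                 × (lookup b i ≡ true → ArcLeftExposed {n} m i)
                 × (lookup b i ≡ false → lookup ℓ i ≡ lookup ℓ (p i))

    IsBl⇔PointValid : IsBl {d} {n} (m , b , ℓ) ⇔ (∀ i → PointValid i)
    IsBl⇔PointValid = mk⇔ (λ { (_ , same , blob , label) i → same i , blob i , label i })
                           (λ valid → tl , proj₁ ∘ valid , proj₁ ∘ proj₂ ∘ valid , proj₂ ∘ proj₂ ∘ valid)

    PointValid-partner : ∀ {i} → PointValid i → PointValid (p i)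
    PointValid-partner {i} (same , blob , label) =
        trans (sym same) (cong (lookup b) (sym (p-involutive i)))
      , (λ blobbed → ArcLeftExposed-partner (blob (trans same blobbed)))
      , (λ unblobbed → trans (sym (label (trans same unblobbed))) (cong (lookup ℓ) (sym (p-involutive i))))

    arcData : Fin (n + n) → (Bool × Fin d) × (Bool × Fin d)
    arcData i = (lookup b i , lookup ℓ i) , (lookup b (p i) , lookup ℓ (p i))

    PointValid⇔ArcDecoration : ∀ {i} → i ≺ p i → PointValid i ⇔ ArcDecoration (exposed i) (arcData i)
    PointValid⇔ArcDecoration lower = mk⇔
      (λ { (same , blob , label) → Equivalence.from ArcDecoration-⇔ (same , Equivalence.to exposure ∘ blob , label) })
      (λ decoration → let (same , blob , label) = Equivalence.to ArcDecoration-⇔ decoration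
                      in same , Equivalence.from exposure ∘ blob , label)
      where exposure = ArcLeftExposed⇔exposed lower

    pairUp-zip : pairUp ends-↔ (zip b ℓ) ≡ tabulate (arcData ∘ lowerEnd)
    pairUp-zip = tabulate-cong λ t → cong₂ _,_ (lookup-zip (lowerEnd t) b ℓ) (lookup-zip (p (lowerEnd t)) b ℓ)

    IsBl⇔Pointwise : IsBl {d} {n} (m , b , ℓ)
                   ⇔ Pointwise (ArcDecoration {d} ∘ exposed) (tabulate lowerEnd) (pairUp ends-↔ (zip b ℓ))
    IsBl⇔Pointwise = mk⇔
      (λ isBl → subst (Pointwise _ _) (sym pairUp-zip)
                  (tabulate⁺ λ t → Equivalence.to (arc t) (Equivalence.to IsBl⇔PointValid isBl (lowerEnd t))))
      (λ decorated → Equivalence.from IsBl⇔PointValid (Equivalence.from (∀-split-⇔ ends-↔) λ t →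
         let valid = Equivalence.from (arc t) (tabulate⁻ (subst (Pointwise _ _) pairUp-zip decorated) t)
         in valid , PointValid-partner valid))
      where arc = λ t → PointValid⇔ArcDecoration (lowerEnd-lower t)

  #exposed : ℕ
  #exposed = count (leftExposedAt? {n} m) (tabulate lowerEnd)

  #exposed≡#leftExposed : #exposed ≡ #leftExposed {n} m
  #exposed≡#leftExposed = trans (↔⇒≡ (begin
    Fin #exposed                                       ↔⟨ ↔-sym (Σ-True-tabulate-↔ exposed? lowerEnd) ⟩
    Σ (Fin #arcs) (λ t → True (exposed? (lowerEnd t))) ↔⟨ Σ-lowerEnd-↔ (λ _ → proj₁ ∘ toWitness) ⟩
    Σ (Fin (n + n)) (λ i → True (exposed? i))          ↔⟨ Σ-True-tabulate-↔ exposed? id ⟩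
    Fin (count exposed? (tabulate id))                 ∎))
    (count-tabulate≡length-filter exposed? id)
    where
    open EquationalReasoning
    exposed? = leftExposedAt? {n} m

  #arcs≡n : #arcs ≡ n
  #arcs≡n = m+m≡n+n⇒m≡n #arcs+#arcs≡N

  #leftExposed≤n : #leftExposed {n} m ≤ n
  #leftExposed≤n = subst₂ _≤_ #exposed≡#leftExposed #arcs≡n (count≤n (leftExposedAt? {n} m) (tabulate lowerEnd))

  encode-↔ : (Vec Bool (n + n) × Vec (Fin d) (n + n)) ↔ Vec ((Bool × Fin d) × (Bool × Fin d)) #arcs
  encode-↔ = ↔-trans ×v↔v× (pairUp-↔ ends-↔)

  Decorations-↔ : Decorations d n m ↔ Fin (d ^ n * suc d ^ #leftExposed {n} m)
  Decorations-↔ = begin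
    Decorations d n m
      ↔⟨ Σ-↔ encode-↔ (λ { {b , ℓ} → True-⇔-↔ (isBl? {d} {n} (m , b , ℓ))
                                                (Pointwise-irrelevant ArcDecoration-irrelevant)
                                                (IsBl⇔Pointwise b ℓ) }) ⟩
    Σ (Vec ((Bool × Fin d) × (Bool × Fin d)) #arcs) (Pointwise (ArcDecoration {d} ∘ exposed) (tabulate lowerEnd))
      ↔⟨ Σ-Pointwise-↔ (leftExposedAt? {n} m) (ArcDecoration-↔ ∘ exposed) (tabulate lowerEnd) ⟩
    Fin (d ^ #arcs * suc d ^ #exposed)
      ≡⟨ cong Fin (cong₂ (λ a k → d ^ a * suc d ^ k) #arcs≡n #exposed≡#leftExposed) ⟩
    Fin (d ^ n * suc d ^ #leftExposed {n} m) ∎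
    where open EquationalReasoning

-- Blobbed diagrams grouped by their underlying TL-diagram

TL : ℕ → Set
TL n = Σ (RawMatching n) (λ m → True (isTL? {n} m))

isTL : ∀ {n} (a : TL n) → IsTL {n} (proj₁ a)
isTL {n} (m , tl) = toWitness {a? = isTL? {n} m} tl

Bl-↔ : ∀ {d n} → Bl d n ↔ Σ (TL n) (Decorations d n ∘ proj₁)
Bl-↔ {d} {n} = mk↔ₛ′
  (λ { ((m , bℓ) , valid) → (m , fromWitness (proj₁ (toWitness {a? = isBl? {d} {n} (m , bℓ)} valid))) , (bℓ , valid) })
  (λ { ((m , _) , (bℓ , valid)) → (m , bℓ) , valid })
  (λ { ((m , _) , (bℓ , valid)) → cong (λ tl → (m , tl) , (bℓ , valid)) (T-irrelevant _ _) })
  (λ _ → refl)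

TLWithExposed-↔ : ∀ {n} k → Σ (TL n) (λ a → #leftExposed {n} (proj₁ a) ≡ k) ↔ TLWithExposed n k
TLWithExposed-↔ {n} k = mk↔ₛ′
  (λ { ((m , tl) , exposed) → m , fromWitness (toWitness {a? = isTL? {n} m} tl , exposed) })
  (λ { (m , valid) → let (tl , exposed) = toWitness {a? = isTL? {n} m ×-dec (#leftExposed {n} m ≟ k)} valid
                     in (m , fromWitness tl) , exposed })
  (λ { (m , _) → cong (m ,_) (T-irrelevant _ _) })
  (λ { ((m , _) , _) → cong₂ (λ tl exposed → (m , tl) , exposed) (T-irrelevant _ _) (≡-irrelevant _ _) })

first-point-leftExposed : ∀ n (m : RawMatching (suc n)) → FixedPointFree {suc n} m → LeftExposedAt {suc n} m zero
first-point-leftExposed n m fpf = ≤∧≢⇒< z≤n (λ eq → fpf zero (sym (toℕ-injective eq))) , λ _ ()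

1≤#leftExposed : ∀ n (m : RawMatching (suc n)) → FixedPointFree {suc n} m → 1 ≤ #leftExposed {suc n} m
1≤#leftExposed n m fpf =
  subst (1 ≤_) (sym (cong List.length (filter-accept (leftExposedAt? {suc n} m) (first-point-leftExposed n m fpf))))
        (s≤s z≤n)

theorem5p9 : (d n : ℕ) → 1 ≤ d → 1 ≤ n → (χ : ℕ → ℕ)
    → (∀ k → 1 ≤ k → k ≤ n → HasCard (TLWithExposed n k) (χ k))
    → HasCard (Bl d n) (d ^ n * sum1to n (λ k → χ k * (1 + d) ^ k))
theorem5p9 d (suc n) _ (s≤s z≤n) χ χ-card = begin
  Bl d (suc n)
    ↔⟨ Bl-↔ {d} {suc n} ⟩
  Σ (TL (suc n)) (Decorations d (suc n) ∘ proj₁)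
    ↔⟨ Σ-partition-↔ (#leftExposed {suc n} ∘ proj₁) (Decorations d (suc n) ∘ proj₁)
         (λ a → Decoration.Decorations-↔ d (suc n) (proj₁ a) (isTL {suc n} a))
         (λ a → 1≤#leftExposed n (proj₁ a) (proj₂ (proj₁ (isTL {suc n} a))))
         (λ a → Decoration.#leftExposed≤n d (suc n) (proj₁ a) (isTL {suc n} a))
         χ (λ k 1≤k k≤n → ↔-trans (TLWithExposed-↔ {suc n} k) (χ-card k 1≤k k≤n)) ⟩
  Fin (sum1to (suc n) (λ k → χ k * (d ^ suc n * (1 + d) ^ k)))
    ≡⟨ cong Fin (trans (sum1to-cong (suc n) λ k → x∙yz≈y∙xz (χ k) (d ^ suc n) ((1 + d) ^ k))
                       (sum1to-*ˡ (d ^ suc n) (λ k → χ k * (1 + d) ^ k) (suc n))) ⟩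
  Fin (d ^ suc n * sum1to (suc n) (λ k → χ k * (1 + d) ^ k)) ∎
  where open EquationalReasoning
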